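{- Let $q=2^m$, where $m$ is a positive integer, let $a\in\mathbb{F}_q^*$, and let $f_1(X)=X^{2q^2}+aX^{q^2+q-1}+aX^{q^2-q+1}$, which is a permutation polynomial of $\mathbb{F}_{q^3}$. Define $P_1(X)=X^{q+2}+X^{2q+1}+X^{q^2+2q}+X^{2q^2+q}$, $P_2(X)=X+a^2$, $\mathrm{Tr}_q^{q^3}(X)=X+X^q+X^{q^2}$, and $$P_3(X)=\Big(\big(a^2P_1(X)+a^4\,\mathrm{Tr}_q^{q^3}(X)^2+X^{1+2q+q^2}\big)\,P_2(X)^{q^3-q^2-2}\Big)^{q^3/4},$$ so that $P_3(X)^4=\big(a^2P_1(X)+a^4\mathrm{Tr}_q^{q^3}(X)^2+X^{1+2q+q^2}\big)P_2(X)^{q^3-q^2-2}$ on $\mathbb{F}_{q^3}$. Then the compositional inverse of $f_1$ over $\mathbb{F}_{q^3}$ is given by $$f_1^{ -1}(X)=(X+a^2)^{q^3-1}P_3(X)+a\prod_{\beta\in\mathbb{F}_{q^3},\,\beta\neq a^2}(X-\beta)^{q^3-1}.$$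
   Context: For a permutation polynomial $f$ of $\mathbb{F}_Q$, its compositional inverse $f^{ -1}$ is the unique polynomial modulo $X^Q-X$ with $f(f^{ -1}(x))=f^{ -1}(f(x))=x$ for all $x\in\mathbb{F}_Q$. Here $q^3/4=2^{3m-2}$ is a positive integer exponent. -}

module Defs where

open import Level using (Level; _⊔_) renaming (suc to lsuc)
open import Data.Nat using (ℕ; suc; _∸_; _/_) renaming (_^_ to _^ℕ_; _*_ to _*ℕ_; _+_ to _+ℕ_)
open import Data.List using (List; []; _∷_; length; filter; map)
open import Data.Product using (∃)
open import Relation.Nullary using (¬_; ¬?)
open import Relation.Binary using (Decidable)
open import Relation.Binary.PropositionalEquality using (_≡_)
open import Algebra.Bundles using (CommutativeRing; Semiring)
import Algebra.Definitions.RawSemiring as RawSemiringDefs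
import Data.List.Membership.Setoid as SetoidMembership
import Data.List.Relation.Unary.Unique.Setoid as SetoidUnique

record FiniteField (c ℓ : Level) : Set (lsuc (c ⊔ ℓ)) where
  field
    commutativeRing : CommutativeRing c ℓ
  open CommutativeRing commutativeRing public
  open RawSemiringDefs (Semiring.rawSemiring semiring) public using (_^_)
  field
    0≉1       : ¬ (0# ≈ 1#)
    inverse   : ∀ x → ¬ (x ≈ 0#) → ∃ λ y → x * y ≈ 1#
    _≟_       : Decidable _≈_
    elements  : List Carrier
    complete  : ∀ x → SetoidMembership._∈_ setoid x elements
    unique    : SetoidUnique.Unique setoid elements

  order : ℕ
  order = length elements

  prod : List Carrier → Carrier
  prod []       = 1#
  prod (x ∷ xs) = x * prod xs

module Prop31 {c ℓ : Level} (F : FiniteField c ℓ) (m : ℕ) (a : FiniteField.Carrier F) where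
  open FiniteField F

  q : ℕ
  q = 2 ^ℕ m

  Q : ℕ
  Q = q ^ℕ 3

  f₁ : Carrier → Carrier
  f₁ x = x ^ (2 *ℕ q ^ℕ 2) + a * x ^ (q ^ℕ 2 +ℕ q ∸ 1) + a * x ^ (q ^ℕ 2 ∸ q +ℕ 1)

  P₁ : Carrier → Carrier
  P₁ x = x ^ (q +ℕ 2) + x ^ (2 *ℕ q +ℕ 1) + x ^ (q ^ℕ 2 +ℕ 2 *ℕ q) + x ^ (2 *ℕ q ^ℕ 2 +ℕ q)

  P₂ : Carrier → Carrier
  P₂ x = x + a ^ 2

  Tr : Carrier → Carrier
  Tr x = x + x ^ q + x ^ (q ^ℕ 2)

  P₃ : Carrier → Carrier
  P₃ x = ((a ^ 2 * P₁ x + a ^ 4 * (Tr x) ^ 2 + x ^ (1 +ℕ 2 *ℕ q +ℕ q ^ℕ 2))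
            * (P₂ x) ^ (Q ∸ q ^ℕ 2 ∸ 2)) ^ (Q / 4)

  f₁inv : Carrier → Carrier
  f₁inv x = (x + a ^ 2) ^ (Q ∸ 1) * P₃ x
            + a * prod (map (λ β → (x - β) ^ (Q ∸ 1))
                                      (filter (λ β → ¬? (β ≟ (a ^ 2))) elements))

{-# OPTIONS --safe #-}
-- The field has characteristic 2 and x^{q³} = x.  Put t₀ = x^{q²+q-1},
-- t₁ = x^{q²-q+1} and t₂ = t₁^q; the Frobenius y ↦ y^q cycles t₀ ↦ t₁ ↦ t₂ ↦ t₀,
-- t₁t₂ = x², and f₁(x) = g(t₀,t₁) with g(u,v) = (u+a)(v+a)+a², a being fixed by
-- the Frobenius.  So y = f₁(x), y^q, y^{q²} are g(t₀,t₁), g(t₁,t₂), g(t₂,t₀), and a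
-- polynomial identity in t₀, t₁, t₂, a turns the numerator of P₃(y) into
-- x⁴(y+a²)(y^{q²}+a²).  For y ≠ a² the factor P₂(y)^{q³-q²-2} completes
-- (y+a²)^{1+q²} to (y+a²)^{q³-1} = 1, and the q³/4-th power of x⁴ is x; for
-- y = a² one of t₀, t₁ equals a, whence x² = t₁t₂ = a².  The products of the
-- (X-β)^{q³-1} select between these two cases, and on a finite set a left
-- inverse is also a right inverse.
module Submission where

open import Defs
open import Level using (Level; 0ℓ)
open import Data.Nat using (ℕ; zero; suc; pred; _≤_; z≤n; s≤s; _∸_; _/_)
  renaming (_^_ to _^ℕ_; _*_ to _*ℕ_; _+_ to _+ℕ_)
import Data.Nat.Properties as ℕ
open import Data.Bool.Base using (Bool; true; false; _xor_; _∧_; if_then_else_)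
import Data.Bool.Properties as Bool
import Data.Maybe.Base as Maybe
open import Data.List using (List; []; _∷_; length; map; filter; _++_; foldr)
open import Data.List.Properties using (length-map; length-++; ++-identityʳ)
open import Data.List.Relation.Unary.All as All using (All; []; _∷_)
open import Data.List.Relation.Unary.All.Properties as AllProperties using (all-filter)
open import Data.List.Relation.Unary.Any as Any using (Any; here; there)
import Data.List.Relation.Unary.Any.Properties as AnyProperties
open import Data.List.Relation.Unary.AllPairs using (_∷_)
open import Data.Product using (∃; _×_; _,_; proj₁; proj₂)
open import Data.Sum using (_⊎_; inj₁; inj₂)
open import Function.Base using (_∘_)
open import Relation.Nullary using (¬_; ¬?; Dec; yes; no; contradiction)
open import Relation.Binary using (Setoid)
open import Relation.Binary.Consequences using (dec⇒weaklyDec)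
open import Relation.Binary.PropositionalEquality as ≡ using (_≡_)
open import Algebra.Bundles using (CommutativeRing; RawRing)
open import Algebra.Solver.Ring.AlmostCommutativeRing
  using (fromCommutativeRing; _-Raw-AlmostCommutative⟶_)

𝔽₂ : RawRing 0ℓ 0ℓ
𝔽₂ = record
  { Carrier = Bool ; _≈_ = _≡_ ; _+_ = _xor_ ; _*_ = _∧_
  ; -_ = λ b → b ; 0# = false ; 1# = true }

HasCharacteristic2 : ∀ {c ℓ} → CommutativeRing c ℓ → Set ℓ
HasCharacteristic2 R = 1# + 1# ≈ 0#
  where open CommutativeRing R

-- The ring solver over 𝔽₂ coefficients, sound in every commutative ring of
-- characteristic 2.
module Characteristic2 {c ℓ} (R : CommutativeRing c ℓ) (1+1≈0 : HasCharacteristic2 R) where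

  open CommutativeRing R
  open import Algebra.Properties.Ring ring using (-0#≈0#)
  open import Algebra.Properties.Semiring.Exp semiring using (_^_; ^-congˡ; ^-assocʳ)
  open import Relation.Binary.Reasoning.Setoid setoid

  -1#≈1# : - 1# ≈ 1#
  -1#≈1# = begin
    - 1#              ≈⟨ +-identityʳ _ ⟨
    - 1# + 0#         ≈⟨ +-congˡ 1+1≈0 ⟨
    - 1# + (1# + 1#)  ≈⟨ +-assoc _ _ _ ⟨
    (- 1# + 1#) + 1#  ≈⟨ +-congʳ (-‿inverseˡ 1#) ⟩
    0# + 1#           ≈⟨ +-identityˡ _ ⟩
    1#                ∎

  ⟦_⟧₂ : Bool → Carrier
  ⟦ b ⟧₂ = if b then 1# else 0#

  𝔽₂-homomorphism : 𝔽₂ -Raw-AlmostCommutative⟶ fromCommutativeRing R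
  𝔽₂-homomorphism = record
    { ⟦_⟧ = ⟦_⟧₂ ; +-homo = +-homo ; *-homo = *-homo ; -‿homo = -‿homo
    ; 0-homo = refl ; 1-homo = refl }
    where
    +-homo : ∀ b d → ⟦ b xor d ⟧₂ ≈ ⟦ b ⟧₂ + ⟦ d ⟧₂
    +-homo false _     = sym (+-identityˡ _)
    +-homo true  false = sym (+-identityʳ _)
    +-homo true  true  = sym 1+1≈0
    *-homo : ∀ b d → ⟦ b ∧ d ⟧₂ ≈ ⟦ b ⟧₂ * ⟦ d ⟧₂
    *-homo false _     = sym (zeroˡ _)
    *-homo true  false = sym (zeroʳ _)
    *-homo true  true  = sym (*-identityˡ _)
    -‿homo : ∀ b → ⟦ b ⟧₂ ≈ - ⟦ b ⟧₂
    -‿homo false = sym -0#≈0#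
    -‿homo true  = sym -1#≈1#

  open import Algebra.Solver.Ring 𝔽₂ (fromCommutativeRing R) 𝔽₂-homomorphism
    (λ b d → Maybe.map (reflexive ∘ ≡.cong ⟦_⟧₂) (dec⇒weaklyDec Bool._≟_ b d))
    public using (solve; _:=_; _:+_; _:*_; _:^_)

  x≈[x+y]+y : ∀ x y → x ≈ (x + y) + y
  x≈[x+y]+y = solve 2 (λ x y → x := (x :+ y) :+ y) refl

  x+x≈0 : ∀ x → x + x ≈ 0#
  x+x≈0 x = begin
    x + x                ≈⟨ +-cong (*-identityˡ x) (*-identityˡ x) ⟨
    1# * x + 1# * x      ≈⟨ distribʳ x 1# 1# ⟨
    (1# + 1#) * x        ≈⟨ *-congʳ 1+1≈0 ⟩
    0# * x               ≈⟨ zeroˡ x ⟩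
    0#                   ∎

  x+y≈0⇒x≈y : ∀ {x y} → x + y ≈ 0# → x ≈ y
  x+y≈0⇒x≈y {x} {y} x+y≈0 = begin
    x              ≈⟨ x≈[x+y]+y x y ⟩
    (x + y) + y    ≈⟨ +-congʳ x+y≈0 ⟩
    0# + y         ≈⟨ +-identityˡ y ⟩
    y              ∎

  x≈y⇒x+y≈0 : ∀ {x y} → x ≈ y → x + y ≈ 0#
  x≈y⇒x+y≈0 {x} {y} x≈y = trans (+-congʳ x≈y) (x+x≈0 y)

  x+y≈y⇒x≈0 : ∀ {x y} → x + y ≈ y → x ≈ 0#
  x+y≈y⇒x≈0 {x} {y} x+y≈y = begin
    x              ≈⟨ x≈[x+y]+y x y ⟩
    (x + y) + y    ≈⟨ +-congʳ x+y≈y ⟩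
    y + y          ≈⟨ x+x≈0 y ⟩
    0#             ∎

  [x+y]^2^k≈x^2^k+y^2^k : ∀ k x y → (x + y) ^ (2 ^ℕ k) ≈ x ^ (2 ^ℕ k) + y ^ (2 ^ℕ k)
  [x+y]^2^k≈x^2^k+y^2^k zero    = solve 2 (λ x y → (x :+ y) :^ 1 := x :^ 1 :+ y :^ 1) refl
  [x+y]^2^k≈x^2^k+y^2^k (suc k) x y = begin
    (x + y) ^ (2 *ℕ 2 ^ℕ k)                  ≈⟨ ^-assocʳ (x + y) 2 (2 ^ℕ k) ⟨
    ((x + y) ^ 2) ^ (2 ^ℕ k)                 ≈⟨ ^-congˡ (2 ^ℕ k) (+-^2 x y) ⟩
    (x ^ 2 + y ^ 2) ^ (2 ^ℕ k)               ≈⟨ [x+y]^2^k≈x^2^k+y^2^k k (x ^ 2) (y ^ 2) ⟩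
    (x ^ 2) ^ (2 ^ℕ k) + (y ^ 2) ^ (2 ^ℕ k)  ≈⟨ +-cong (^-assocʳ x 2 (2 ^ℕ k)) (^-assocʳ y 2 (2 ^ℕ k)) ⟩
    x ^ (2 *ℕ 2 ^ℕ k) + y ^ (2 *ℕ 2 ^ℕ k)    ∎
    where
    +-^2 : ∀ x y → (x + y) ^ 2 ≈ x ^ 2 + y ^ 2
    +-^2 = solve 2 (λ x y → (x :+ y) :^ 2 := x :^ 2 :+ y :^ 2) refl

module UniqueLists {a ℓ} (S : Setoid a ℓ) where

  open Setoid S
  open import Data.List.Membership.Setoid S using (_∈_)
  open import Data.List.Membership.Setoid.Properties using (∈-∃++; ∈-map⁻; ∈-resp-≈)
  open import Data.List.Relation.Binary.Subset.Setoid S using (_⊆_)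
  open import Data.List.Relation.Binary.Permutation.Setoid S
    using (_↭_; ↭-trans; ↭-reflexive-≋; ↭-reflexive; prep)
  open import Data.List.Relation.Binary.Permutation.Setoid.Properties S
    using (shift; ∈-resp-↭; xs↭ys⇒|xs|≡|ys|)
  open import Data.List.Relation.Unary.Unique.Setoid S using (Unique)
  open import Data.List.Relation.Unary.Unique.Setoid.Properties using (map⁺; Unique[x∷xs]⇒x∉xs)

  unique-⊆⇒↭++ : ∀ {xs ys} → Unique xs → xs ⊆ ys → ∃ λ zs → ys ↭ xs ++ zs
  unique-⊆⇒↭++ {[]}     {ys} _ _ = ys , ↭-reflexive ≡.refl
  unique-⊆⇒↭++ {x ∷ xs} {ys} x∷xs!@(_ ∷ xs!) x∷xs⊆ys
    with as , bs , w , x≈w , ys≋ ← ∈-∃++ S (x∷xs⊆ys (here refl)) =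
    let ys↭x∷as++bs = ↭-trans (↭-reflexive-≋ ys≋) (shift (sym x≈w) as bs)
        zs , as++bs↭xs++zs = unique-⊆⇒↭++ xs! (xs⊆as++bs ys↭x∷as++bs)
    in zs , ↭-trans ys↭x∷as++bs (prep refl as++bs↭xs++zs)
    where
    xs⊆as++bs : ys ↭ x ∷ as ++ bs → xs ⊆ as ++ bs
    xs⊆as++bs ys↭ z∈xs with ∈-resp-↭ ys↭ (x∷xs⊆ys (there z∈xs))
    ... | here z≈x  = contradiction (∈-resp-≈ S z≈x z∈xs) (Unique[x∷xs]⇒x∉xs S x∷xs!)
    ... | there z∈  = z∈

  ↭++⇒length≡ : ∀ {ys} xs zs → ys ↭ xs ++ zs → length ys ≡ length xs +ℕ length zs
  ↭++⇒length≡ xs _ ys↭ = ≡.trans (xs↭ys⇒|xs|≡|ys| ys↭) (length-++ xs)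

  unique-⊆⇒length≤ : ∀ {xs ys} → Unique xs → xs ⊆ ys → length xs ≤ length ys
  unique-⊆⇒length≤ {xs} xs! xs⊆ys with zs , ys↭ ← unique-⊆⇒↭++ xs! xs⊆ys =
    ℕ.≤-trans (ℕ.m≤m+n _ (length zs)) (ℕ.≤-reflexive (≡.sym (↭++⇒length≡ xs zs ys↭)))

  unique-⊆-length≤⇒↭ : ∀ {xs ys} → Unique xs → xs ⊆ ys → length ys ≤ length xs → ys ↭ xs
  unique-⊆-length≤⇒↭ {xs} xs! xs⊆ys |ys|≤|xs| with unique-⊆⇒↭++ xs! xs⊆ys
  ... | []     , ys↭ = ↭-trans ys↭ (↭-reflexive (++-identityʳ xs))
  ... | z ∷ zs , ys↭ = contradiction |ys|≤|xs| (ℕ.<⇒≱ (ℕ.<-≤-trans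
        (ℕ.m<m+n (length xs) (s≤s z≤n)) (ℕ.≤-reflexive (≡.sym (↭++⇒length≡ xs (z ∷ zs) ys↭)))))

  leftInverse⇒rightInverse : ∀ {xs} → Unique xs → (∀ x → x ∈ xs) →
    ∀ {f g : Carrier → Carrier} → (∀ {x y} → x ≈ y → f x ≈ f y) → (∀ {x y} → x ≈ y → g x ≈ g y) →
    (∀ x → g (f x) ≈ x) → ∀ y → f (g y) ≈ y
  leftInverse⇒rightInverse {xs} xs! ∈xs {f} {g} f-cong g-cong g∘f≈id y =
    let x , _ , y≈fx = ∈-map⁻ S S (∈-resp-↭ xs↭f[xs] (∈xs y)) in begin
      f (g y)       ≈⟨ f-cong (g-cong y≈fx) ⟩
      f (g (f x))   ≈⟨ f-cong (g∘f≈id x) ⟩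
      f x           ≈⟨ y≈fx ⟨
      y             ∎
    where
    open import Relation.Binary.Reasoning.Setoid S
    f-injective : ∀ {x y} → f x ≈ f y → x ≈ y
    f-injective {x} {y} fx≈fy = trans (sym (g∘f≈id x)) (trans (g-cong fx≈fy) (g∘f≈id y))
    xs↭f[xs] : xs ↭ map f xs
    xs↭f[xs] = unique-⊆-length≤⇒↭ (map⁺ S S f-injective xs!) (λ {z} _ → ∈xs z)
                 (ℕ.≤-reflexive (≡.sym (length-map f xs)))

module FiniteFieldOfOrder {c ℓ} (F : FiniteField c ℓ) {Q : ℕ}
  (order≡Q : FiniteField.order F ≡ Q) where

  open FiniteField F
  open import Algebra.Properties.Ring ring using (-1*x≈-x; -‿involutive; x∙y⁻¹≈ε⇒x≈y; x≈y⇒x∙y⁻¹≈ε)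
  open import Algebra.Properties.Semiring.Exp semiring using (^-congˡ; ^-assocʳ)
  open import Algebra.Properties.CommutativeSemigroup *-commutativeSemigroup using (interchange)
  open import Relation.Binary.Reasoning.Setoid setoid
  open import Data.List.Membership.Setoid setoid using (_∈_)
  open import Data.List.Membership.Setoid.Properties using (∈-filter⁺; ∈-filter⁻; ∈-map⁻)
  open import Data.List.Relation.Unary.Unique.Setoid setoid using (Unique)
  import Data.List.Relation.Unary.Unique.Setoid.Properties as Unique
  open import Data.List.Relation.Binary.Permutation.Setoid setoid using (_↭_)
  open import Data.List.Relation.Binary.Permutation.Setoid.Properties setoid
    using (foldr-commMonoid)
  open UniqueLists setoid

  *-cancelˡ : ∀ {x y z} → x ≉ 0# → x * y ≈ x * z → y ≈ z
  *-cancelˡ {x} {y} {z} x≉0 xy≈xz = let x⁻¹ , xx⁻¹≈1 = inverse x x≉0 in begin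
    y                ≈⟨ *-identityˡ y ⟨
    1# * y           ≈⟨ *-congʳ (trans (sym xx⁻¹≈1) (*-comm x x⁻¹)) ⟩
    (x⁻¹ * x) * y    ≈⟨ *-assoc x⁻¹ x y ⟩
    x⁻¹ * (x * y)    ≈⟨ *-congˡ xy≈xz ⟩
    x⁻¹ * (x * z)    ≈⟨ *-assoc x⁻¹ x z ⟨
    (x⁻¹ * x) * z    ≈⟨ *-congʳ (trans (*-comm x⁻¹ x) xx⁻¹≈1) ⟩
    1# * z           ≈⟨ *-identityˡ z ⟩
    z                ∎

  x*y≈0⇒x≈0⊎y≈0 : ∀ {x y} → x * y ≈ 0# → x ≈ 0# ⊎ y ≈ 0#
  x*y≈0⇒x≈0⊎y≈0 {x} {y} xy≈0 with x ≟ 0#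
  ... | yes x≈0 = inj₁ x≈0
  ... | no  x≉0 = inj₂ (*-cancelˡ x≉0 (trans xy≈0 (sym (zeroʳ x))))

  x≉0∧y≉0⇒x*y≉0 : ∀ {x y} → x ≉ 0# → y ≉ 0# → x * y ≉ 0#
  x≉0∧y≉0⇒x*y≉0 x≉0 y≉0 xy≈0 with x*y≈0⇒x≈0⊎y≈0 xy≈0
  ... | inj₁ x≈0 = x≉0 x≈0
  ... | inj₂ y≈0 = y≉0 y≈0

  1#^n≈1# : ∀ n → 1# ^ n ≈ 1#
  1#^n≈1# zero    = refl
  1#^n≈1# (suc n) = trans (*-identityˡ _) (1#^n≈1# n)

  prod≡foldr : ∀ xs → prod xs ≡ foldr _*_ 1# xs
  prod≡foldr []       = ≡.refl
  prod≡foldr (x ∷ xs) = ≡.cong (x *_) (prod≡foldr xs)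

  prod-≈1 : ∀ {xs} → All (_≈ 1#) xs → prod xs ≈ 1#
  prod-≈1 []           = refl
  prod-≈1 (x≈1 ∷ xs≈1) = trans (*-cong x≈1 (prod-≈1 xs≈1)) (*-identityˡ 1#)

  prod-≈0 : ∀ {xs} → Any (_≈ 0#) xs → prod xs ≈ 0#
  prod-≈0 (here x≈0)   = trans (*-congʳ x≈0) (zeroˡ _)
  prod-≈0 (there xs≈0) = trans (*-congˡ (prod-≈0 xs≈0)) (zeroʳ _)

  prod-≉0 : ∀ {xs} → All (_≉ 0#) xs → prod xs ≉ 0#
  prod-≉0 []           = 0≉1 ∘ sym
  prod-≉0 (x≉0 ∷ xs≉0) = x≉0∧y≉0⇒x*y≉0 x≉0 (prod-≉0 xs≉0)

  prod-map-x* : ∀ x ws → prod (map (x *_) ws) ≈ x ^ length ws * prod ws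
  prod-map-x* x []       = sym (*-identityˡ 1#)
  prod-map-x* x (w ∷ ws) = begin
    x * w * prod (map (x *_) ws)        ≈⟨ *-congˡ (prod-map-x* x ws) ⟩
    x * w * (x ^ length ws * prod ws)   ≈⟨ interchange x w _ _ ⟩
    x * x ^ length ws * (w * prod ws)   ∎

  nonzero? : ∀ x → Dec (x ≉ 0#)
  nonzero? x = ¬? (x ≟ 0#)

  nonzeros : List Carrier
  nonzeros = filter nonzero? elements

  private
    ≉0-resp-≈ : ∀ {x y} → x ≈ y → x ≉ 0# → y ≉ 0#
    ≉0-resp-≈ x≈y x≉0 y≈0 = x≉0 (trans x≈y y≈0)

  nonzeros-unique : Unique nonzeros
  nonzeros-unique = Unique.filter⁺ setoid nonzero? unique

  ∈-nonzeros⁺ : ∀ {x} → x ≉ 0# → x ∈ nonzeros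
  ∈-nonzeros⁺ {x} = ∈-filter⁺ setoid nonzero? ≉0-resp-≈ (complete x)

  ∈-nonzeros⁻ : ∀ {x} → x ∈ nonzeros → x ≉ 0#
  ∈-nonzeros⁻ x∈ = proj₂ (∈-filter⁻ setoid nonzero? ≉0-resp-≈ {xs = elements} x∈)

  suc|nonzeros|≡Q : suc (length nonzeros) ≡ Q
  suc|nonzeros|≡Q = ≡.trans (ℕ.≤-antisym
    (unique-⊆⇒length≤ 0∷nonzeros-unique (λ {z} _ → complete z))
    (unique-⊆⇒length≤ unique elements⊆0∷nonzeros)) order≡Q
    where
    0∷nonzeros-unique : Unique (0# ∷ nonzeros)
    0∷nonzeros-unique = All.tabulateₛ setoid (λ x∈ 0≈x → ∈-nonzeros⁻ x∈ (sym 0≈x))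
                        ∷ nonzeros-unique
    elements⊆0∷nonzeros : ∀ {x} → x ∈ elements → x ∈ 0# ∷ nonzeros
    elements⊆0∷nonzeros {x} _ with x ≟ 0#
    ... | yes x≈0 = here x≈0
    ... | no  x≉0 = there (∈-nonzeros⁺ x≉0)

  Q∸1≡|nonzeros| : Q ∸ 1 ≡ length nonzeros
  Q∸1≡|nonzeros| = ≡.cong (_∸ 1) (≡.sym suc|nonzeros|≡Q)

  -- Multiplication by x ≉ 0 permutes the nonzero elements, so their
  -- product P satisfies P ≈ x ^ (Q ∸ 1) * P with P ≉ 0.
  ^[Q∸1]-nonzero : ∀ {x} → x ≉ 0# → x ^ (Q ∸ 1) ≈ 1#
  ^[Q∸1]-nonzero {x} x≉0 = ≡.subst (λ n → x ^ n ≈ 1#) (≡.sym Q∸1≡|nonzeros|)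
    (sym (*-cancelˡ (prod-≉0 (All.tabulateₛ setoid ∈-nonzeros⁻)) (begin
      prod nonzeros * 1#                        ≈⟨ *-identityʳ _ ⟩
      prod nonzeros                             ≡⟨ prod≡foldr nonzeros ⟩
      foldr _*_ 1# nonzeros                     ≈⟨ foldr-commMonoid *-isCommutativeMonoid nonzeros↭x*nonzeros ⟩
      foldr _*_ 1# (map (x *_) nonzeros)        ≡⟨ prod≡foldr (map (x *_) nonzeros) ⟨
      prod (map (x *_) nonzeros)                ≈⟨ prod-map-x* x nonzeros ⟩
      x ^ length nonzeros * prod nonzeros       ≈⟨ *-comm _ _ ⟩
      prod nonzeros * x ^ length nonzeros       ∎)))
    where
    x*nonzeros⊆nonzeros : ∀ {z} → z ∈ map (x *_) nonzeros → z ∈ nonzeros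
    x*nonzeros⊆nonzeros z∈ = let w , w∈ , z≈xw = ∈-map⁻ setoid setoid z∈ in
      ∈-nonzeros⁺ (≉0-resp-≈ (sym z≈xw) (x≉0∧y≉0⇒x*y≉0 x≉0 (∈-nonzeros⁻ w∈)))
    nonzeros↭x*nonzeros : nonzeros ↭ map (x *_) nonzeros
    nonzeros↭x*nonzeros = unique-⊆-length≤⇒↭
      (Unique.map⁺ setoid setoid (*-cancelˡ x≉0) nonzeros-unique) x*nonzeros⊆nonzeros
      (ℕ.≤-reflexive (≡.sym (length-map (x *_) nonzeros)))

  ^[Q∸1]-zero : ∀ {x} → x ≈ 0# → x ^ (Q ∸ 1) ≈ 0#
  ^[Q∸1]-zero {x} x≈0 = ≡.subst (λ n → x ^ n ≈ 0#) (≡.sym Q∸1≡|nonzeros|)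
    (nonempty⇒^length≈0 (∈-nonzeros⁺ (0≉1 ∘ sym)))
    where
    nonempty⇒^length≈0 : ∀ {y xs} → y ∈ xs → x ^ length xs ≈ 0#
    nonempty⇒^length≈0 {xs = _ ∷ _} _ = trans (*-congʳ x≈0) (zeroˡ _)

  ^Q≈id : ∀ x → x ^ Q ≈ x
  ^Q≈id x = ≡.subst (λ n → x ^ n ≈ x) suc|nonzeros|≡Q (≡.subst (λ n → x * x ^ n ≈ x) Q∸1≡|nonzeros| x*x^[Q∸1]≈x)
    where
    x*x^[Q∸1]≈x : x * x ^ (Q ∸ 1) ≈ x
    x*x^[Q∸1]≈x with x ≟ 0#
    ... | yes x≈0 = trans (*-congʳ x≈0) (trans (zeroˡ _) (sym x≈0))
    ... | no  x≉0 = trans (*-congˡ (^[Q∸1]-nonzero x≉0)) (*-identityʳ x)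

  Q≡2k⇒1+1≈0 : ∀ k → Q ≡ 2 *ℕ k → HasCharacteristic2 commutativeRing
  Q≡2k⇒1+1≈0 k Q≡2k = begin
    1# + 1#     ≈⟨ +-congʳ -1#≈1# ⟨
    - 1# + 1#   ≈⟨ -‿inverseˡ 1# ⟩
    0#          ∎
    where
    [-1]²≈1 : (- 1#) ^ 2 ≈ 1#
    [-1]²≈1 = begin
      - 1# * (- 1# * 1#)   ≈⟨ -1*x≈-x _ ⟩
      - (- 1# * 1#)        ≈⟨ -‿cong (*-identityʳ _) ⟩
      - - 1#               ≈⟨ -‿involutive 1# ⟩
      1#                   ∎
    -1#≈1# : - 1# ≈ 1#
    -1#≈1# = begin
      - 1#                 ≈⟨ ^Q≈id (- 1#) ⟨
      (- 1#) ^ Q           ≡⟨ ≡.cong ((- 1#) ^_) Q≡2k ⟩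
      (- 1#) ^ (2 *ℕ k)    ≈⟨ ^-assocʳ (- 1#) 2 k ⟨
      ((- 1#) ^ 2) ^ k     ≈⟨ ^-congˡ k [-1]²≈1 ⟩
      1# ^ k               ≈⟨ 1#^n≈1# k ⟩
      1#                   ∎

  x²≈y²⇒x≈y : HasCharacteristic2 commutativeRing → ∀ {x y} → x ^ 2 ≈ y ^ 2 → x ≈ y
  x²≈y²⇒x≈y 1+1≈0 {x} {y} x²≈y² = x+y≈0⇒x≈y (x²≈0⇒x≈0 (begin
    (x + y) ^ 2      ≈⟨ [x+y]^2^k≈x^2^k+y^2^k 1 x y ⟩
    x ^ 2 + y ^ 2    ≈⟨ x≈y⇒x+y≈0 x²≈y² ⟩
    0#               ∎))
    where
    open Characteristic2 commutativeRing 1+1≈0 using (x+y≈0⇒x≈y; x≈y⇒x+y≈0; [x+y]^2^k≈x^2^k+y^2^k)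
    x²≈0⇒x≈0 : ∀ {z} → z ^ 2 ≈ 0# → z ≈ 0#
    x²≈0⇒x≈0 {z} z²≈0 with x*y≈0⇒x≈0⊎y≈0 z²≈0
    ... | inj₁ z≈0  = z≈0
    ... | inj₂ z1≈0 = trans (sym (*-identityʳ z)) z1≈0

  _∖_ : List Carrier → Carrier → List Carrier
  xs ∖ c = filter (λ β → ¬? (β ≟ c)) xs

  ∏[y-β]^[Q∸1] : Carrier → List Carrier → Carrier
  ∏[y-β]^[Q∸1] y βs = prod (map (λ β → (y - β) ^ (Q ∸ 1)) βs)

  ∏[y-β]^[Q∸1]-≈1 : ∀ {c y} xs → y ≈ c → ∏[y-β]^[Q∸1] y (xs ∖ c) ≈ 1#
  ∏[y-β]^[Q∸1]-≈1 {c} {y} xs y≈c =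
    prod-≈1 (AllProperties.map⁺ (All.map factor≈1 (all-filter (λ β → ¬? (β ≟ c)) xs)))
    where
    factor≈1 : ∀ {β} → β ≉ c → (y - β) ^ (Q ∸ 1) ≈ 1#
    factor≈1 {β} β≉c = ^[Q∸1]-nonzero (λ y-β≈0 → β≉c (trans (sym (x∙y⁻¹≈ε⇒x≈y y β y-β≈0)) y≈c))

  ∏[y-β]^[Q∸1]-≈0 : ∀ {c y xs} → y ∈ xs → y ≉ c → ∏[y-β]^[Q∸1] y (xs ∖ c) ≈ 0#
  ∏[y-β]^[Q∸1]-≈0 {c} y∈xs y≉c = prod-≈0 (AnyProperties.map⁺ (Any.map (^[Q∸1]-zero ∘ x≈y⇒x∙y⁻¹≈ε)
    (∈-filter⁺ setoid (λ β → ¬? (β ≟ c)) (λ x≈y x≉c y≈c → x≉c (trans x≈y y≈c)) y∈xs y≉c)))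


2^n≡2[1+s] : ∀ {n} → 1 ≤ n → ∃ λ s → 2 ^ℕ n ≡ 2 *ℕ suc s
2^n≡2[1+s] {suc n} _ = pred (2 ^ℕ n) , ≡.cong (2 *ℕ_) (≡.sym (ℕ.suc-pred (2 ^ℕ n) {{ℕ.m^n≢0 2 n}}))

module Exponents (q s : ℕ) (q≡2[1+s] : q ≡ 2 *ℕ suc s) where

  open import Data.Nat.Solver using (module +-*-Solver)
  open +-*-Solver using (Polynomial; solve; _:=_; _:+_; _:*_; _:^_; con)
  open import Data.Nat.Divisibility using (divides)
  open import Data.Nat.DivMod using (m*[n/m]≡n)

  e₀ e₁ : ℕ
  e₀ = q ^ℕ 2 +ℕ q ∸ 1
  e₁ = q ^ℕ 2 ∸ q +ℕ 1

  private
    ∸-≡ : ∀ {m} n {o} → m ≡ n +ℕ o → m ∸ n ≡ o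
    ∸-≡ n {o} ≡.refl = ℕ.m+n∸m≡n n o

    2[1+_] : ∀ {n} → Polynomial n → Polynomial n
    2[1+ s ] = con 2 :* (con 1 :+ s)

    q²∸q≡ : q ^ℕ 2 ∸ q ≡ q *ℕ (1 +ℕ 2 *ℕ s)
    q²∸q≡ rewrite q≡2[1+s] = ∸-≡ (2 *ℕ suc s) (solve 1 (λ s → let q = 2[1+ s ] in
      q :^ 2 := q :+ q :* (con 1 :+ con 2 :* s)) ≡.refl s)

    e₀≡ : e₀ ≡ q ^ℕ 2 +ℕ (1 +ℕ 2 *ℕ s)
    e₀≡ rewrite q≡2[1+s] = ∸-≡ 1 (solve 1 (λ s → let q = 2[1+ s ] in
      q :^ 2 :+ q := con 1 :+ (q :^ 2 :+ (con 1 :+ con 2 :* s))) ≡.refl s)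

    e₁≡ : e₁ ≡ q *ℕ (1 +ℕ 2 *ℕ s) +ℕ 1
    e₁≡ = ≡.cong (_+ℕ 1) q²∸q≡

    q³∸q²∸2≡ : q ^ℕ 3 ∸ q ^ℕ 2 ∸ 2 ≡ 2 +ℕ 16 *ℕ s +ℕ 20 *ℕ s ^ℕ 2 +ℕ 8 *ℕ s ^ℕ 3
    q³∸q²∸2≡ rewrite q≡2[1+s] = ∸-≡ 2 (∸-≡ ((2 *ℕ suc s) ^ℕ 2) (solve 1 (λ s → let q = 2[1+ s ] in
      q :^ 3 := q :^ 2 :+ (con 2 :+ (con 2 :+ con 16 :* s :+ con 20 :* s :^ 2 :+ con 8 :* s :^ 3)))
      ≡.refl s))

  e₀+e₁≡2q² : e₀ +ℕ e₁ ≡ 2 *ℕ q ^ℕ 2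
  e₀+e₁≡2q² rewrite e₀≡ | e₁≡ | q≡2[1+s] = solve 1 (λ s → let q = 2[1+ s ] in
    q :^ 2 :+ (con 1 :+ con 2 :* s) :+ (q :* (con 1 :+ con 2 :* s) :+ con 1) := con 2 :* q :^ 2) ≡.refl s

  e₀*q≡q³+[q²∸q] : e₀ *ℕ q ≡ q ^ℕ 3 +ℕ (q ^ℕ 2 ∸ q)
  e₀*q≡q³+[q²∸q] rewrite e₀≡ | q²∸q≡ | q≡2[1+s] = solve 1 (λ s → let q = 2[1+ s ] in
    (q :^ 2 :+ (con 1 :+ con 2 :* s)) :* q := q :^ 3 :+ q :* (con 1 :+ con 2 :* s)) ≡.refl s

  e₁+e₁*q≡q³+1 : e₁ +ℕ e₁ *ℕ q ≡ q ^ℕ 3 +ℕ 1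
  e₁+e₁*q≡q³+1 rewrite e₁≡ | q≡2[1+s] = solve 1 (λ s →
    let q = 2[1+ s ] ; e₁ = q :* (con 1 :+ con 2 :* s) :+ con 1 in e₁ :+ e₁ :* q := q :^ 3 :+ con 1) ≡.refl s

  1+q²+[q³∸q²∸2]≡q³∸1 : 1 +ℕ q ^ℕ 2 +ℕ (q ^ℕ 3 ∸ q ^ℕ 2 ∸ 2) ≡ q ^ℕ 3 ∸ 1
  1+q²+[q³∸q²∸2]≡q³∸1 rewrite q³∸q²∸2≡ | q≡2[1+s] = ≡.sym (∸-≡ 1 (solve 1 (λ s → let q = 2[1+ s ] in
    q :^ 3 := con 1 :+ (con 1 :+ q :^ 2 :+ (con 2 :+ con 16 :* s :+ con 20 :* s :^ 2 :+ con 8 :* s :^ 3)))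
    ≡.refl s))

  4*[q³/4]≡q³ : 4 *ℕ (q ^ℕ 3 / 4) ≡ q ^ℕ 3
  4*[q³/4]≡q³ = m*[n/m]≡n (divides (2 *ℕ suc s ^ℕ 3) q³≡2[1+s]³*4)
    where
    q³≡2[1+s]³*4 : q ^ℕ 3 ≡ 2 *ℕ suc s ^ℕ 3 *ℕ 4
    q³≡2[1+s]³*4 rewrite q≡2[1+s] = solve 1 (λ s →
      2[1+ s ] :^ 3 := con 2 :* (con 1 :+ s) :^ 3 :* con 4) ≡.refl s

  q³≡2*[[1+s]*q²] : q ^ℕ 3 ≡ 2 *ℕ (suc s *ℕ q ^ℕ 2)
  q³≡2*[[1+s]*q²] = ≡.trans (≡.cong (_*ℕ q ^ℕ 2) q≡2[1+s]) (ℕ.*-assoc 2 (suc s) (q ^ℕ 2))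

module Proposition3p1 {c ℓ} (F : FiniteField c ℓ) (m : ℕ) (1≤m : 1 ≤ m)
  (|F|≡2^[3m] : FiniteField.order F ≡ 2 ^ℕ (3 *ℕ m))
  (a : FiniteField.Carrier F) (a^q≈a : FiniteField._≈_ F (FiniteField._^_ F a (2 ^ℕ m)) a) where

  open FiniteField F
  open Prop31 F m a
  open import Algebra.Properties.Semiring.Exp semiring using (^-congˡ; ^-homo-*; ^-assocʳ)
  open import Algebra.Properties.CommutativeSemiring.Exp commutativeSemiring using (^-distrib-*)
  open import Relation.Binary.Reasoning.Setoid setoid

  order≡Q : order ≡ Q
  order≡Q = ≡.trans |F|≡2^[3m] (≡.trans (≡.cong (2 ^ℕ_) (ℕ.*-comm 3 m)) (≡.sym (ℕ.^-*-assoc 2 m 3)))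

  open FiniteFieldOfOrder F order≡Q

  s : ℕ
  s = proj₁ (2^n≡2[1+s] 1≤m)

  open Exponents q s (proj₂ (2^n≡2[1+s] 1≤m))

  1+1≈0 : HasCharacteristic2 commutativeRing
  1+1≈0 = Q≡2k⇒1+1≈0 (suc s *ℕ q ^ℕ 2) q³≡2*[[1+s]*q²]

  open Characteristic2 commutativeRing 1+1≈0
    using (solve; _:=_; _:+_; _:*_; _:^_; x+y≈0⇒x≈y; x≈y⇒x+y≈0; x+y≈y⇒x≈0; [x+y]^2^k≈x^2^k+y^2^k)

  ^q-distrib-+ : ∀ x y → (x + y) ^ q ≈ x ^ q + y ^ q
  ^q-distrib-+ = [x+y]^2^k≈x^2^k+y^2^k m

  ^2-^q-comm : ∀ x → (x ^ 2) ^ q ≈ (x ^ q) ^ 2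
  ^2-^q-comm x = begin
    (x ^ 2) ^ q     ≈⟨ ^-assocʳ x 2 q ⟩
    x ^ (2 *ℕ q)    ≡⟨ ≡.cong (x ^_) (ℕ.*-comm 2 q) ⟩
    x ^ (q *ℕ 2)    ≈⟨ ^-assocʳ x q 2 ⟨
    (x ^ q) ^ 2     ∎

  ^q²≈^q^q : ∀ x → x ^ (q ^ℕ 2) ≈ (x ^ q) ^ q
  ^q²≈^q^q x = begin
    x ^ (q ^ℕ 2)    ≡⟨ ≡.cong (λ n → x ^ (q *ℕ n)) (ℕ.*-identityʳ q) ⟩
    x ^ (q *ℕ q)    ≈⟨ ^-assocʳ x q q ⟨
    (x ^ q) ^ q     ∎

  ^q^q^q≈id : ∀ x → ((x ^ q) ^ q) ^ q ≈ x
  ^q^q^q≈id x = begin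
    ((x ^ q) ^ q) ^ q   ≈⟨ ^-congˡ q (^q²≈^q^q x) ⟨
    (x ^ (q ^ℕ 2)) ^ q  ≈⟨ ^-assocʳ x (q ^ℕ 2) q ⟩
    x ^ (q ^ℕ 2 *ℕ q)   ≡⟨ ≡.cong (x ^_) (ℕ.*-comm (q ^ℕ 2) q) ⟩
    x ^ Q               ≈⟨ ^Q≈id x ⟩
    x                   ∎

  a²^q≈a² : (a ^ 2) ^ q ≈ a ^ 2
  a²^q≈a² = trans (^2-^q-comm a) (^-congˡ 2 a^q≈a)

  [u+a²]^q≈u^q+a² : ∀ u → (u + a ^ 2) ^ q ≈ u ^ q + a ^ 2
  [u+a²]^q≈u^q+a² u = trans (^q-distrib-+ u (a ^ 2)) (+-congˡ a²^q≈a²)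

  P₂-^q² : ∀ y → P₂ y ^ (q ^ℕ 2) ≈ (y ^ q) ^ q + a ^ 2
  P₂-^q² y = begin
    (y + a ^ 2) ^ (q ^ℕ 2)     ≈⟨ ^q²≈^q^q (y + a ^ 2) ⟩
    ((y + a ^ 2) ^ q) ^ q      ≈⟨ ^-congˡ q ([u+a²]^q≈u^q+a² y) ⟩
    (y ^ q + a ^ 2) ^ q        ≈⟨ [u+a²]^q≈u^q+a² (y ^ q) ⟩
    (y ^ q) ^ q + a ^ 2        ∎

  g : Carrier → Carrier → Carrier
  g u v = (u + a) * (v + a) + a ^ 2

  g-cong : ∀ {u u' v v'} → u ≈ u' → v ≈ v' → g u v ≈ g u' v'
  g-cong u≈u' v≈v' = +-congʳ (*-cong (+-congʳ u≈u') (+-congʳ v≈v'))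

  g-^q : ∀ u v → g u v ^ q ≈ g (u ^ q) (v ^ q)
  g-^q u v = begin
    ((u + a) * (v + a) + a ^ 2) ^ q         ≈⟨ [u+a²]^q≈u^q+a² _ ⟩
    ((u + a) * (v + a)) ^ q + a ^ 2         ≈⟨ +-congʳ (^-distrib-* (u + a) (v + a) q) ⟩
    (u + a) ^ q * (v + a) ^ q + a ^ 2       ≈⟨ +-congʳ (*-cong ([w+a]^q≈w^q+a u) ([w+a]^q≈w^q+a v)) ⟩
    (u ^ q + a) * (v ^ q + a) + a ^ 2       ∎
    where
    [w+a]^q≈w^q+a : ∀ w → (w + a) ^ q ≈ w ^ q + a
    [w+a]^q≈w^q+a w = trans (^q-distrib-+ w a) (+-congˡ a^q≈a)

  numerator : Carrier → Carrier → Carrier → Carrier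
  numerator y₀ y₁ y₂ = a ^ 2 * (y₁ * y₀ ^ 2 + y₁ ^ 2 * y₀ + y₂ * y₁ ^ 2 + y₂ ^ 2 * y₁)
                     + a ^ 4 * (y₀ + y₁ + y₂) ^ 2 + y₀ * y₁ ^ 2 * y₂

  numerator-cong : ∀ {y₀ y₀' y₁ y₁' y₂ y₂'} → y₀ ≈ y₀' → y₁ ≈ y₁' → y₂ ≈ y₂' →
                   numerator y₀ y₁ y₂ ≈ numerator y₀' y₁' y₂'
  numerator-cong e₀ e₁ e₂ = +-cong (+-cong
    (*-congˡ (+-cong (+-cong (+-cong (*-cong e₁ (^-congˡ 2 e₀)) (*-cong (^-congˡ 2 e₁) e₀))
                             (*-cong e₂ (^-congˡ 2 e₁))) (*-cong (^-congˡ 2 e₂) e₁)))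
    (*-congˡ (^-congˡ 2 (+-cong (+-cong e₀ e₁) e₂))))
    (*-cong (*-cong e₀ (^-congˡ 2 e₁)) e₂)

  numerator-expand : ∀ y → a ^ 2 * P₁ y + a ^ 4 * Tr y ^ 2 + y ^ (1 +ℕ 2 *ℕ q +ℕ q ^ℕ 2)
                           ≈ numerator y (y ^ q) ((y ^ q) ^ q)
  numerator-expand y = +-cong (+-cong (*-congˡ P₁≈) (*-congˡ (^-congˡ 2 (+-congˡ (^q²≈^q^q y))))) y^[1+2q+q²]≈
    where
    y^2q≈ : y ^ (2 *ℕ q) ≈ (y ^ q) ^ 2
    y^2q≈ = trans (sym (^-assocʳ y 2 q)) (^2-^q-comm y)
    y^2q²≈ : y ^ (2 *ℕ q ^ℕ 2) ≈ ((y ^ q) ^ q) ^ 2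
    y^2q²≈ = begin
      y ^ (2 *ℕ q ^ℕ 2)    ≡⟨ ≡.cong (y ^_) (ℕ.*-comm 2 (q ^ℕ 2)) ⟩
      y ^ (q ^ℕ 2 *ℕ 2)    ≈⟨ ^-assocʳ y (q ^ℕ 2) 2 ⟨
      (y ^ (q ^ℕ 2)) ^ 2   ≈⟨ ^-congˡ 2 (^q²≈^q^q y) ⟩
      ((y ^ q) ^ q) ^ 2    ∎
    P₁≈ : P₁ y ≈ y ^ q * y ^ 2 + (y ^ q) ^ 2 * y + (y ^ q) ^ q * (y ^ q) ^ 2 + ((y ^ q) ^ q) ^ 2 * y ^ q
    P₁≈ = +-cong (+-cong (+-cong
      (^-homo-* y q 2)
      (trans (^-homo-* y (2 *ℕ q) 1) (*-cong y^2q≈ (*-identityʳ y))))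
      (trans (^-homo-* y (q ^ℕ 2) (2 *ℕ q)) (*-cong (^q²≈^q^q y) y^2q≈)))
      (trans (^-homo-* y (2 *ℕ q ^ℕ 2) q) (*-congʳ y^2q²≈))
    y^[1+2q+q²]≈ : y ^ (1 +ℕ 2 *ℕ q +ℕ q ^ℕ 2) ≈ y * (y ^ q) ^ 2 * (y ^ q) ^ q
    y^[1+2q+q²]≈ = trans (^-homo-* y (1 +ℕ 2 *ℕ q) (q ^ℕ 2)) (*-cong (*-congˡ y^2q≈) (^q²≈^q^q y))

  numerator-g : ∀ t₀ t₁ t₂ → numerator (g t₀ t₁) (g t₁ t₂) (g t₂ t₀)
                             ≈ (t₁ * t₂) ^ 2 * ((g t₀ t₁ + a ^ 2) * (g t₂ t₀ + a ^ 2))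
  numerator-g t₀ t₁ t₂ = solve 4 (λ t₀ t₁ t₂ a →
    let g = λ u v → (u :+ a) :* (v :+ a) :+ a :^ 2
        y₀ = g t₀ t₁ ; y₁ = g t₁ t₂ ; y₂ = g t₂ t₀
    in a :^ 2 :* (y₁ :* y₀ :^ 2 :+ y₁ :^ 2 :* y₀ :+ y₂ :* y₁ :^ 2 :+ y₂ :^ 2 :* y₁)
       :+ a :^ 4 :* (y₀ :+ y₁ :+ y₂) :^ 2 :+ y₀ :* y₁ :^ 2 :* y₂
       := (t₁ :* t₂) :^ 2 :* ((y₀ :+ a :^ 2) :* (y₂ :+ a :^ 2))) refl t₀ t₁ t₂ a

  module AtPoint (x : Carrier) where

    t₀ t₁ t₂ : Carrier
    t₀ = x ^ e₀
    t₁ = x ^ e₁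
    t₂ = t₁ ^ q

    f₁≈g : f₁ x ≈ g t₀ t₁
    f₁≈g = trans (+-congʳ (+-congʳ x^2q²≈t₀t₁)) (uv+au+av≈g t₀ t₁ a)
      where
      x^2q²≈t₀t₁ : x ^ (2 *ℕ q ^ℕ 2) ≈ t₀ * t₁
      x^2q²≈t₀t₁ = trans (reflexive (≡.cong (x ^_) (≡.sym e₀+e₁≡2q²))) (^-homo-* x e₀ e₁)
      uv+au+av≈g : ∀ u v a → u * v + a * u + a * v ≈ (u + a) * (v + a) + a ^ 2
      uv+au+av≈g = solve 3 (λ u v a → u :* v :+ a :* u :+ a :* v := (u :+ a) :* (v :+ a) :+ a :^ 2) refl

    t₀^q≈t₁ : t₀ ^ q ≈ t₁
    t₀^q≈t₁ = begin
      t₀ ^ q                             ≈⟨ ^-assocʳ x e₀ q ⟩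
      x ^ (e₀ *ℕ q)                      ≡⟨ ≡.cong (x ^_) e₀*q≡q³+[q²∸q] ⟩
      x ^ (Q +ℕ (q ^ℕ 2 ∸ q))            ≈⟨ ^-homo-* x Q (q ^ℕ 2 ∸ q) ⟩
      x ^ Q * x ^ (q ^ℕ 2 ∸ q)           ≈⟨ *-congʳ (^Q≈id x) ⟩
      x ^ suc (q ^ℕ 2 ∸ q)               ≡⟨ ≡.cong (x ^_) (ℕ.+-comm 1 (q ^ℕ 2 ∸ q)) ⟩
      t₁                                 ∎

    t₂^q≈t₀ : t₂ ^ q ≈ t₀
    t₂^q≈t₀ = trans (^-congˡ q (^-congˡ q (sym t₀^q≈t₁))) (^q^q^q≈id t₀)

    t₁t₂≈x² : t₁ * t₂ ≈ x ^ 2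
    t₁t₂≈x² = begin
      t₁ * t₁ ^ q                 ≈⟨ *-congˡ (^-assocʳ x e₁ q) ⟩
      t₁ * x ^ (e₁ *ℕ q)          ≈⟨ ^-homo-* x e₁ (e₁ *ℕ q) ⟨
      x ^ (e₁ +ℕ e₁ *ℕ q)         ≡⟨ ≡.cong (x ^_) e₁+e₁*q≡q³+1 ⟩
      x ^ (Q +ℕ 1)                ≈⟨ ^-homo-* x Q 1 ⟩
      x ^ Q * x ^ 1               ≈⟨ *-congʳ (^Q≈id x) ⟩
      x ^ 2                       ∎

    f₁^q≈g : f₁ x ^ q ≈ g t₁ t₂
    f₁^q≈g = trans (^-congˡ q f₁≈g) (trans (g-^q t₀ t₁) (g-cong t₀^q≈t₁ refl))

    f₁^q^q≈g : (f₁ x ^ q) ^ q ≈ g t₂ t₀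
    f₁^q^q≈g = trans (^-congˡ q f₁^q≈g) (trans (g-^q t₁ t₂) (g-cong refl t₂^q≈t₀))

    numerator≈x⁴P₂P₂^q² : numerator (f₁ x) (f₁ x ^ q) ((f₁ x ^ q) ^ q)
                          ≈ x ^ 4 * (P₂ (f₁ x) * P₂ (f₁ x) ^ (q ^ℕ 2))
    numerator≈x⁴P₂P₂^q² = begin
      numerator (f₁ x) (f₁ x ^ q) ((f₁ x ^ q) ^ q)
        ≈⟨ numerator-cong f₁≈g f₁^q≈g f₁^q^q≈g ⟩
      numerator (g t₀ t₁) (g t₁ t₂) (g t₂ t₀)
        ≈⟨ numerator-g t₀ t₁ t₂ ⟩
      (t₁ * t₂) ^ 2 * ((g t₀ t₁ + a ^ 2) * (g t₂ t₀ + a ^ 2))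
        ≈⟨ *-cong (^-congˡ 2 t₁t₂≈x²) (*-cong (+-congʳ (sym f₁≈g))
                  (trans (+-congʳ (sym f₁^q^q≈g)) (sym (P₂-^q² (f₁ x))))) ⟩
      (x ^ 2) ^ 2 * (P₂ (f₁ x) * P₂ (f₁ x) ^ (q ^ℕ 2))
        ≈⟨ *-congʳ (^-assocʳ x 2 2) ⟩
      x ^ 4 * (P₂ (f₁ x) * P₂ (f₁ x) ^ (q ^ℕ 2))
        ∎

    P₃≈x : f₁ x ≉ a ^ 2 → P₃ (f₁ x) ≈ x
    P₃≈x f₁x≉a² = begin
      P₃ (f₁ x)            ≈⟨ ^-congˡ (Q / 4) N*D^E≈x⁴ ⟩
      (x ^ 4) ^ (Q / 4)    ≈⟨ ^-assocʳ x 4 (Q / 4) ⟩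
      x ^ (4 *ℕ (Q / 4))   ≡⟨ ≡.cong (x ^_) 4*[q³/4]≡q³ ⟩
      x ^ Q                ≈⟨ ^Q≈id x ⟩
      x                    ∎
      where
      D : Carrier
      D = P₂ (f₁ x)
      E : ℕ
      E = Q ∸ q ^ℕ 2 ∸ 2
      N*D^E≈x⁴ : (a ^ 2 * P₁ (f₁ x) + a ^ 4 * Tr (f₁ x) ^ 2 + f₁ x ^ (1 +ℕ 2 *ℕ q +ℕ q ^ℕ 2)) * D ^ E
                 ≈ x ^ 4
      N*D^E≈x⁴ = begin
        _ * D ^ E                            ≈⟨ *-congʳ (trans (numerator-expand (f₁ x)) numerator≈x⁴P₂P₂^q²) ⟩
        x ^ 4 * (D * D ^ (q ^ℕ 2)) * D ^ E   ≈⟨ *-assoc _ _ _ ⟩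
        x ^ 4 * (D ^ (1 +ℕ q ^ℕ 2) * D ^ E)  ≈⟨ *-congˡ (^-homo-* D (1 +ℕ q ^ℕ 2) E) ⟨
        x ^ 4 * D ^ (1 +ℕ q ^ℕ 2 +ℕ E)       ≡⟨ ≡.cong (λ n → x ^ 4 * D ^ n) 1+q²+[q³∸q²∸2]≡q³∸1 ⟩
        x ^ 4 * D ^ (Q ∸ 1)                  ≈⟨ *-congˡ (^[Q∸1]-nonzero (f₁x≉a² ∘ x+y≈0⇒x≈y)) ⟩
        x ^ 4 * 1#                           ≈⟨ *-identityʳ _ ⟩
        x ^ 4                                ∎

    f₁≈a²⇒x≈a : f₁ x ≈ a ^ 2 → x ≈ a
    f₁≈a²⇒x≈a f₁x≈a² = x²≈y²⇒x≈y 1+1≈0 (begin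
      x ^ 2      ≈⟨ t₁t₂≈x² ⟨
      t₁ * t₂    ≈⟨ *-cong t₁≈a (trans (^-congˡ q t₁≈a) a^q≈a) ⟩
      a * a      ≈⟨ *-congˡ (*-identityʳ a) ⟨
      a ^ 2      ∎)
      where
      t₁≈a : t₁ ≈ a
      t₁≈a with x*y≈0⇒x≈0⊎y≈0 (x+y≈y⇒x≈0 (trans (sym f₁≈g) f₁x≈a²))
      ... | inj₁ t₀+a≈0 = trans (sym t₀^q≈t₁) (trans (^-congˡ q (x+y≈0⇒x≈y t₀+a≈0)) a^q≈a)
      ... | inj₂ t₁+a≈0 = x+y≈0⇒x≈y t₁+a≈0

  f₁inv-a² : ∀ {y} → y ≈ a ^ 2 → f₁inv y ≈ a
  f₁inv-a² {y} y≈a² = begin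
    (y + a ^ 2) ^ (Q ∸ 1) * P₃ y + a * ∏[y-β]^[Q∸1] y (elements ∖ (a ^ 2))
      ≈⟨ +-cong (trans (*-congʳ (^[Q∸1]-zero (x≈y⇒x+y≈0 y≈a²))) (zeroˡ _))
                (*-congˡ (∏[y-β]^[Q∸1]-≈1 elements y≈a²)) ⟩
    0# + a * 1#   ≈⟨ trans (+-identityˡ _) (*-identityʳ a) ⟩
    a             ∎

  f₁inv-≉a² : ∀ {y} → y ≉ a ^ 2 → f₁inv y ≈ P₃ y
  f₁inv-≉a² {y} y≉a² = begin
    (y + a ^ 2) ^ (Q ∸ 1) * P₃ y + a * ∏[y-β]^[Q∸1] y (elements ∖ (a ^ 2))
      ≈⟨ +-cong (*-congʳ (^[Q∸1]-nonzero (y≉a² ∘ x+y≈0⇒x≈y)))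
                (*-congˡ (∏[y-β]^[Q∸1]-≈0 (complete y) y≉a²)) ⟩
    1# * P₃ y + a * 0#   ≈⟨ +-cong (*-identityˡ _) (zeroʳ a) ⟩
    P₃ y + 0#            ≈⟨ +-identityʳ _ ⟩
    P₃ y                 ∎

  f₁inv∘f₁≈id : ∀ x → f₁inv (f₁ x) ≈ x
  f₁inv∘f₁≈id x with f₁ x ≟ (a ^ 2)
  ... | yes f₁x≈a² = trans (f₁inv-a² f₁x≈a²) (sym (AtPoint.f₁≈a²⇒x≈a x f₁x≈a²))
  ... | no  f₁x≉a² = trans (f₁inv-≉a² f₁x≉a²) (AtPoint.P₃≈x x f₁x≉a²)

  f₁-cong : ∀ {x x'} → x ≈ x' → f₁ x ≈ f₁ x'
  f₁-cong x≈x' = +-cong (+-cong (^-congˡ (2 *ℕ q ^ℕ 2) x≈x') (*-congˡ (^-congˡ e₀ x≈x')))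
                        (*-congˡ (^-congˡ e₁ x≈x'))

  f₁inv-cong : ∀ {y y'} → y ≈ y' → f₁inv y ≈ f₁inv y'
  f₁inv-cong {y} {y'} y≈y' =
    +-cong (*-cong (^-congˡ (Q ∸ 1) P₂-cong) P₃-cong) (*-congˡ (∏-cong (elements ∖ (a ^ 2))))
    where
    ^-cong : ∀ n → y ^ n ≈ y' ^ n
    ^-cong n = ^-congˡ n y≈y'
    P₂-cong : P₂ y ≈ P₂ y'
    P₂-cong = +-congʳ y≈y'
    P₁-cong : P₁ y ≈ P₁ y'
    P₁-cong = +-cong (+-cong (+-cong (^-cong (q +ℕ 2)) (^-cong (2 *ℕ q +ℕ 1)))
                       (^-cong (q ^ℕ 2 +ℕ 2 *ℕ q))) (^-cong (2 *ℕ q ^ℕ 2 +ℕ q))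
    Tr-cong : Tr y ≈ Tr y'
    Tr-cong = +-cong (+-cong y≈y' (^-cong q)) (^-cong (q ^ℕ 2))
    P₃-cong : P₃ y ≈ P₃ y'
    P₃-cong = ^-congˡ (Q / 4) (*-cong
      (+-cong (+-cong (*-congˡ P₁-cong) (*-congˡ (^-congˡ 2 Tr-cong))) (^-cong (1 +ℕ 2 *ℕ q +ℕ q ^ℕ 2)))
      (^-congˡ (Q ∸ q ^ℕ 2 ∸ 2) P₂-cong))
    ∏-cong : ∀ βs → ∏[y-β]^[Q∸1] y βs ≈ ∏[y-β]^[Q∸1] y' βs
    ∏-cong []       = refl
    ∏-cong (β ∷ βs) = *-cong (^-congˡ (Q ∸ 1) (+-congʳ y≈y')) (∏-cong βs)

  f₁∘f₁inv≈id : ∀ y → f₁ (f₁inv y) ≈ y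
  f₁∘f₁inv≈id =
    UniqueLists.leftInverse⇒rightInverse setoid unique complete f₁-cong f₁inv-cong f₁inv∘f₁≈id

proposition3p1 : {c ℓ : Level} (F : FiniteField c ℓ) (m : ℕ) → 1 ≤ m
    → FiniteField.order F ≡ 2 ^ℕ (3 *ℕ m)
    → (a : FiniteField.Carrier F)
    → FiniteField._≈_ F (FiniteField._^_ F a (2 ^ℕ m)) a
    → ¬ FiniteField._≈_ F a (FiniteField.0# F)
    → (∀ x → FiniteField._≈_ F (Prop31.f₁inv F m a (Prop31.f₁ F m a x)) x)
      × (∀ x → FiniteField._≈_ F (Prop31.f₁ F m a (Prop31.f₁inv F m a x)) x)
-- The argument never uses a ≉ 0.
proposition3p1 F m 1≤m |F|≡2^[3m] a a^q≈a _ = f₁inv∘f₁≈id , f₁∘f₁inv≈id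
  where open Proposition3p1 F m 1≤m |F|≡2^[3m] a a^q≈a
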